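{- Let $F_1$ be the graph with vertex set $\{x, y, v_1, \ldots, v_6\}$ and edge set $\{xv_3, xv_6, yv_1, yv_4, v_1v_2, v_1v_6, v_2v_3, v_3v_4, v_4v_5, v_5v_6\}$, and let $F_2$ be the graph with vertex set $\{x, y, v_1, \ldots, v_{10}\}$ and edge set $\{xv_1, xv_8, yv_6, yv_9, v_1v_2, v_1v_6, v_1v_7, v_2v_3, v_3v_4, v_3v_8, v_4v_5, v_4v_9, v_5v_6, v_6v_{10}, v_7v_9, v_8v_{10}\}$. Then both $F_1$ and $F_2$ are HIST-critical $\{x,y\}$-fragments.
   Context: For a tree or forest $\Upsilon$, $d_\Upsilon(v)$ denotes the degree of $v$ in $\Upsilon$. Let $F$ be a graph with vertex set $\{x, y, v_1, \ldots, v_\ell\}$, $\ell \ge 1$, $x \ne y$. For a subgraph $H$ of $F$, a spanning tree (resp. spanning forest) $\Upsilon$ of $H$ is an $\{x,y\}$-excluded HIST (resp. $\{x,y\}$-excluded HISF) of $H$ if $d_\Upsilon(v) \ne 2$ for all $v \in V(H) \setminus \{x,y\}$. $F$ is a HIST-critical $\{x,y\}$-fragment if all of the following hold: (1) $F$ has an $\{x,y\}$-excluded HIST, and every $\{x,y\}$-excluded HIST $T$ of $F$ satisfies $d_T(x) = d_T(y) = 2$; (2) $F - x$ has an $\{x,y\}$-excluded HIST $T$ with $d_T(y) \ne 1$, and $F - y$ has an $\{x,y\}$-excluded HIST $T$ with $d_T(x) \ne 1$; (3) for every $v \in V(F) \setminus \{x,y\}$, the graph $F - v$ has either (a) an $\{x,y\}$-excluded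 HIST $T$ with $d_T(x) \ne 2$ or $d_T(y) \ne 2$, or (b) an $\{x,y\}$-excluded HISF consisting of exactly two components $T_x$ and $T_y$, each with at least two vertices, such that $x \in V(T_x)$ and $y \in V(T_y)$; (4) $F$ itself has no $\{x,y\}$-excluded HISF consisting of exactly two components $T_x, T_y$, each with at least two vertices, with $x \in V(T_x)$ and $y \in V(T_y)$. -}

module Defs where

open import Data.Nat using (ℕ; zero; suc; _+_; _≤_)
open import Data.Fin using (Fin; zero; suc; _≟_; #_)
open import Data.Fin.Patterns
open import Data.Bool using (Bool; true; false; if_then_else_; _∨_; _∧_; not)
open import Data.List using (List; []; _∷_; _++_; [_]; length; map; allFin)
open import Data.Nat.ListAction using (sum)
open import Data.Vec using (Vec; lookup) renaming ([] to []ᵛ; _∷_ to _∷ᵛ_)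
open import Data.List.Relation.Unary.Unique.Propositional using (Unique)
open import Data.List.Relation.Unary.Linked using (Linked)
open import Data.Product using (Σ; ∃; _×_; _,_; proj₁; proj₂)
open import Data.Sum using (_⊎_)
open import Relation.Nullary using (¬_; does)
open import Relation.Binary.PropositionalEquality using (_≡_; _≢_)
open import Relation.Binary.Construct.Closure.ReflexiveTransitive using (Star)

-- A (simple, undirected) graph on vertex set Fin n with m edges,
-- given by the list of its edges: edge e joins proj₁ (E e) and proj₂ (E e).
Graph : ℕ → ℕ → Set
Graph n m = Fin m → Fin n × Fin n

-- A vertex subset, describing the vertex set of a subgraph H of F
-- (H is the induced subgraph of F on the vertices marked true).
VSet : ℕ → Set
VSet n = Fin n → Bool

allV : ∀ {n} → VSet n
allV _ = true

minus : ∀ {n} → Fin n → VSet n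
minus v w = not (does (w ≟ v))

ESet : ℕ → Set
ESet m = Fin m → Bool

module _ {n m : ℕ} (E : Graph n m) where

  Adj : ESet m → Fin n → Fin n → Set
  Adj S u v = Σ (Fin m) λ e → S e ≡ true × (E e ≡ (u , v) ⊎ E e ≡ (v , u))

  Conn : ESet m → Fin n → Fin n → Set
  Conn S = Star (Adj S)

  incident : Fin m → Fin n → Bool
  incident e v = does (proj₁ (E e) ≟ v) ∨ does (proj₂ (E e) ≟ v)

  deg : ESet m → Fin n → ℕ
  deg S v = sum (map (λ e → if S e ∧ incident e v then 1 else 0) (allFin m))

  HasCycle : ESet m → Set
  HasCycle S = Σ (Fin n) λ v → Σ (List (Fin n)) λ ws →
    2 ≤ length ws × Unique (v ∷ ws) × Linked (Adj S) (v ∷ ws ++ [ v ])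

  EdgesIn : VSet n → ESet m → Set
  EdgesIn K S = ∀ e → S e ≡ true → K (proj₁ (E e)) ≡ true × K (proj₂ (E e)) ≡ true

  SpanningForest : VSet n → ESet m → Set
  SpanningForest K S = EdgesIn K S × ¬ HasCycle S

  SpanningTree : VSet n → ESet m → Set
  SpanningTree K S = SpanningForest K S ×
    (∀ u v → K u ≡ true → K v ≡ true → Conn S u v)

  Excluded : VSet n → Fin n → Fin n → ESet m → Set
  Excluded K x y S = ∀ v → K v ≡ true → v ≢ x → v ≢ y → deg S v ≢ 2

  HIST : VSet n → Fin n → Fin n → ESet m → Set
  HIST K x y S = SpanningTree K S × Excluded K x y S

  HISF : VSet n → Fin n → Fin n → ESet m → Set
  HISF K x y S = SpanningForest K S × Excluded K x y S

  TwoCompHISF : VSet n → Fin n → Fin n → ESet m → Set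
  TwoCompHISF K x y S = HISF K x y S
    × ¬ Conn S x y
    × (∀ v → K v ≡ true → Conn S x v ⊎ Conn S y v)
    × (Σ (Fin n) λ u → u ≢ x × Conn S x u)
    × (Σ (Fin n) λ u → u ≢ y × Conn S y u)

  record HISTCriticalFragment (x y : Fin n) : Set where
    field
      -- vertex set {x, y, v1, ..., vℓ} with ℓ ≥ 1
      x≢y   : x ≢ y
      ℓ≥1   : 3 ≤ n
      c1-exists : Σ (ESet m) λ T → HIST allV x y T
      c1-deg    : ∀ T → HIST allV x y T → deg T x ≡ 2 × deg T y ≡ 2
      c2-x : Σ (ESet m) λ T → HIST (minus x) x y T × deg T y ≢ 1
      c2-y : Σ (ESet m) λ T → HIST (minus y) x y T × deg T x ≢ 1
      c3 : ∀ v → v ≢ x → v ≢ y →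
             (Σ (ESet m) λ T → HIST (minus v) x y T × (deg T x ≢ 2 ⊎ deg T y ≢ 2))
           ⊎ (Σ (ESet m) λ T → TwoCompHISF (minus v) x y T)
      c4 : ¬ (Σ (ESet m) λ T → TwoCompHISF allV x y T)

-- Vertex numbering: x = 0, y = 1, v_i = 1 + i.

F₁ : Graph 8 10
F₁ = lookup
  ( (# 0 , # 4)
  ∷ᵛ (# 0 , # 7)
  ∷ᵛ (# 1 , # 2)
  ∷ᵛ (# 1 , # 5)
  ∷ᵛ (# 2 , # 3)
  ∷ᵛ (# 2 , # 7)
  ∷ᵛ (# 3 , # 4)
  ∷ᵛ (# 4 , # 5)
  ∷ᵛ (# 5 , # 6)
  ∷ᵛ (# 6 , # 7)
  ∷ᵛ []ᵛ)

F₂ : Graph 12 16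
F₂ = lookup
  ( (# 0 , # 2)
  ∷ᵛ (# 0 , # 9)
  ∷ᵛ (# 1 , # 7)
  ∷ᵛ (# 1 , # 10)
  ∷ᵛ (# 2 , # 3)
  ∷ᵛ (# 2 , # 7)
  ∷ᵛ (# 2 , # 8)
  ∷ᵛ (# 3 , # 4)
  ∷ᵛ (# 4 , # 5)
  ∷ᵛ (# 4 , # 9)
  ∷ᵛ (# 5 , # 6)
  ∷ᵛ (# 5 , # 10)
  ∷ᵛ (# 6 , # 7)
  ∷ᵛ (# 7 , # 11)
  ∷ᵛ (# 8 , # 10)
  ∷ᵛ (# 9 , # 11)
  ∷ᵛ []ᵛ)

-- All four conditions are finite statements about the spanning subgraphs of the fragment, and
-- they are established by a verified computation.  The existential parts of (1)–(3) are witnessed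
-- by explicit edge sets: a breadth-first search from the roots supplies a parent function such
-- that every edge of the witness joins a vertex to its parent, one layer closer to the roots,
-- which rules out cycles, and reachability gives the required connectivity.  The universal
-- parts of (1) and (4) are decided by a branch-and-bound search over intervals L ⊆ S ⊆ U of edge
-- sets: an interval is discarded as soon as a reason valid for all of its members applies — an
-- inner vertex of degree 2 in both L and U, a vertex cut off from the roots by a set closed under
-- the edges of U, an x–y path in L or an isolated root (for (4)), or degree 2 at x and at y in
-- both L and U (for (1)).
module Submission where

open import Defs
open import Data.Fin using (#_)
open import Data.Product using (_×_)

open import Data.Bool using (Bool; true; false; T; T?; not; _∧_; _∨_; if_then_else_)
open import Data.Bool.ListAction using (any)
open import Data.Bool.Properties using (T-∧; T-∨; T-≡) renaming (_≟_ to _≟ᵇ_)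
open import Data.Empty using (⊥; ⊥-elim)
open import Data.Fin using (Fin; toℕ; _≟_)
open import Data.Fin.Properties using (all?; any?)
open import Data.List
  using (List; []; _∷_; _++_; [_]; length; allFin; map; mapMaybe; iterate; filterᵇ; findᵇ)
open import Data.List.Membership.Propositional using (_∈_)
open import Data.List.Relation.Unary.All as All using (All; _∷_)
open import Data.List.Relation.Unary.AllPairs using (_∷_)
open import Data.List.Relation.Unary.Any using (here; there; satisfied)
open import Data.List.Relation.Unary.Any.Properties using (any⁻)
open import Data.List.Relation.Unary.Linked as Linked using (Linked; _∷_)
open import Data.List.Relation.Unary.Unique.Propositional using (Unique)
open import Data.Maybe using (Maybe; just; nothing; maybe′)
open import Data.Nat using (ℕ; zero; suc; _≤_; _<_; _<ᵇ_; _≡ᵇ_; z≤n; s≤s; _≤?_; _<?_)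
import Data.Nat as ℕ
open import Data.Nat.ListAction using (sum)
open import Data.Nat.Properties using (≤-refl; ≤-antisym; <-trans; <-irrefl; +-mono-≤)
open import Data.Product using (∃; _,_; proj₁; proj₂)
open import Data.Sum as Sum using (_⊎_; inj₁; inj₂)
open import Data.Unit using (⊤)
open import Data.Vec using (Vec; []; _∷_; lookup; tabulate; replicate; _[_]≔_)
open import Data.Vec.Properties using (lookup∘tabulate; lookup∘update′; lookup-replicate)
open import Function using (_∘_)
open import Function.Bundles using (Equivalence)
open import Relation.Binary.Construct.Closure.ReflexiveTransitive as Star using (ε; _◅_; _◅◅_)
open import Relation.Binary.PropositionalEquality using (_≡_; _≢_; refl; sym; trans; subst; ≢-sym)
open import Relation.Nullary using (Dec; yes; no; ¬_; ¬?; _×-dec_; _⊎-dec_; _→-dec_)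
open import Relation.Nullary.Decidable using (⌊_⌋; toWitness; fromWitness)

infix 4 _⊆_
_⊆_ : ∀ {k} → (Fin k → Bool) → (Fin k → Bool) → Set
S ⊆ S′ = ∀ i → S i ≡ true → S′ i ≡ true

⁅_⁆ : ∀ {n} → Fin n → VSet n
⁅ x ⁆ v = ⌊ v ≟ x ⌋

x∈⁅x⁆ : ∀ {n} (x : Fin n) → T (⁅ x ⁆ x)
x∈⁅x⁆ x = fromWitness refl

infixr 6 _∪_
_∪_ : ∀ {n} → VSet n → VSet n → VSet n
(A ∪ B) v = A v ∨ B v

-- Walks along a parent function

module ParentWalks {A : Set} (parent : A → A) (rank : A → ℕ) where

  infix 4 _↑_ _↓_ _—_
  _↑_ _↓_ _—_ : A → A → Set
  a ↑ b = parent a ≡ b × rank b < rank a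
  a ↓ b = b ↑ a
  a — b = a ↑ b ⊎ a ↓ b

  —-sym : ∀ {a b} → a — b → b — a
  —-sym (inj₁ a↑b) = inj₂ a↑b
  —-sym (inj₂ a↓b) = inj₁ a↓b

  NonBacktracking : List A → Set
  NonBacktracking (a ∷ b ∷ c ∷ xs) = a ≢ c × NonBacktracking (b ∷ c ∷ xs)
  NonBacktracking _                = ⊤

  -- Having come down from a = parent b, the walk cannot go up again without returning to a.
  descend : ∀ {a b} xs z → NonBacktracking (a ∷ b ∷ xs ++ [ z ]) →
            Linked _—_ (b ∷ xs ++ [ z ]) → a ↓ b → rank a < rank z × parent z ∈ b ∷ xs
  descend [] z (a≢z , _) (inj₁ (pb≡z , _) ∷ _) (pb≡a , _) =
    ⊥-elim (a≢z (trans (sym pb≡a) pb≡z))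
  descend [] z _ (inj₂ (pz≡b , b<z) ∷ _) (_ , a<b) = <-trans a<b b<z , here pz≡b
  descend (c ∷ xs) z (a≢c , _) (inj₁ (pb≡c , _) ∷ _) (pb≡a , _) =
    ⊥-elim (a≢c (trans (sym pb≡a) pb≡c))
  descend (c ∷ xs) z (_ , nb) (inj₂ b↓c ∷ walk) (_ , a<b) with descend xs z nb walk b↓c
  ... | b<z , pz∈ = <-trans a<b b<z , there pz∈

  ascend : ∀ {a b} c xs z → NonBacktracking (a ∷ b ∷ c ∷ xs ++ [ z ]) →
           Linked _—_ (b ∷ c ∷ xs ++ [ z ]) → a ↑ b → rank z < rank a ⊎ parent z ∈ c ∷ xs
  ascend c xs z (_ , nb) (inj₂ b↓c ∷ walk) _ = inj₂ (proj₂ (descend xs z nb walk b↓c))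
  ascend c [] z _ (inj₁ (_ , c<b) ∷ inj₁ (_ , z<c) ∷ _) (_ , b<a) =
    inj₁ (<-trans z<c (<-trans c<b b<a))
  ascend c [] z _ (inj₁ _ ∷ inj₂ (pz≡c , _) ∷ _) _ = inj₂ (here pz≡c)
  ascend c (d ∷ xs) z (_ , nb) (inj₁ b↑c ∷ walk) (_ , b<a) with ascend d xs z nb walk b↑c
  ... | inj₁ z<b = inj₁ (<-trans z<b b<a)
  ... | inj₂ pz∈ = inj₂ (there pz∈)

  unique⇒nonBacktracking : ∀ {z} xs → Unique xs → All (_≢ z) xs → NonBacktracking (xs ++ [ z ])
  unique⇒nonBacktracking []                _                   _           = _
  unique⇒nonBacktracking (a ∷ [])          _                   _           = _
  unique⇒nonBacktracking (a ∷ b ∷ [])      _                   (a≢z ∷ _)   = a≢z , _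
  unique⇒nonBacktracking (a ∷ b ∷ c ∷ xs) ((_ ∷ a≢c ∷ _) ∷ u) (_ ∷ ≢z) =
    a≢c , unique⇒nonBacktracking (b ∷ c ∷ xs) u ≢z

  -- A closed walk from v cannot start downwards (the rank would keep growing), so it starts by
  -- going up to parent v; it must then either keep going up (the rank would keep falling) or
  -- return to v from below, i.e. from parent v, which is thus visited twice.
  no-closed-walk : ∀ {v ws} → 2 ≤ length ws → Unique (v ∷ ws) → ¬ Linked _—_ (v ∷ ws ++ [ v ])
  no-closed-walk {ws = _ ∷ []} (s≤s ())
  no-closed-walk {v} {w₁ ∷ w₂ ∷ ws} _ (v∉ ∷ w₁∉ ∷ u) (v—w₁ ∷ walk) = closes v—w₁
    where
    nb : NonBacktracking (v ∷ w₁ ∷ w₂ ∷ ws ++ [ v ])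
    nb = All.lookup v∉ (there (here refl)) ,
         unique⇒nonBacktracking (w₁ ∷ w₂ ∷ ws) (w₁∉ ∷ u) (All.map ≢-sym v∉)

    closes : v — w₁ → ⊥
    closes (inj₂ v↓w₁) = <-irrefl refl (proj₁ (descend (w₂ ∷ ws) v nb walk v↓w₁))
    closes (inj₁ v↑w₁) with ascend w₂ ws v nb walk v↑w₁
    ... | inj₁ v<v = <-irrefl refl v<v
    ... | inj₂ pv∈ = All.lookup w₁∉ (subst (_∈ w₂ ∷ ws) (proj₁ v↑w₁) pv∈) refl

-- Spanning subgraphs of a graph

module Graphs {n m : ℕ} (E : Graph n m) where

  Adj-sym : ∀ {S u v} → Adj E S u v → Adj E S v u
  Adj-sym (e , s , inj₁ uv) = e , s , inj₂ uv
  Adj-sym (e , s , inj₂ vu) = e , s , inj₁ vu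

  Conn-sym : ∀ {S u v} → Conn E S u v → Conn E S v u
  Conn-sym = Star.reverse Adj-sym

  Conn-mono : ∀ {S S′ u v} → S ⊆ S′ → Conn E S u v → Conn E S′ u v
  Conn-mono S⊆S′ = Star.map λ (e , s , joins) → e , S⊆S′ e s , joins

  deg-mono : ∀ {S S′} → S ⊆ S′ → ∀ v → deg E S v ≤ deg E S′ v
  deg-mono {S} {S′} S⊆S′ v = sum-mono (allFin m)
    where
    counted : ESet m → Fin m → ℕ
    counted S e = if S e ∧ incident E e v then 1 else 0

    counted-mono : ∀ e → counted S e ≤ counted S′ e
    counted-mono e with S e in Se
    ... | false = z≤n
    ... | true rewrite S⊆S′ e Se = ≤-refl

    sum-mono : ∀ es → sum (map (counted S) es) ≤ sum (map (counted S′) es)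
    sum-mono []       = z≤n
    sum-mono (e ∷ es) = +-mono-≤ (counted-mono e) (sum-mono es)

  deg-squeeze : ∀ {L S U d} → L ⊆ S → S ⊆ U →
                ∀ v → deg E L v ≡ d → deg E U v ≡ d → deg E S v ≡ d
  deg-squeeze {S = S} L⊆S S⊆U v refl degU≡d =
    ≤-antisym (subst (deg E S v ≤_) degU≡d (deg-mono S⊆U v)) (deg-mono L⊆S v)

  Closed : ESet m → VSet n → Set
  Closed S C = ∀ e → S e ≡ true → C (proj₁ (E e)) ≡ C (proj₂ (E e))

  closed? : ∀ S C → Dec (Closed S C)
  closed? S C = all? λ e → S e ≟ᵇ true →-dec C (proj₁ (E e)) ≟ᵇ C (proj₂ (E e))

  Closed-anti : ∀ {S U} C → S ⊆ U → Closed U C → Closed S C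
  Closed-anti C S⊆U closed e s = closed e (S⊆U e s)

  Conn-preserves-Closed : ∀ {S} C {u v} → Closed S C → Conn E S u v → C u ≡ C v
  Conn-preserves-Closed C closed ε = refl
  Conn-preserves-Closed C closed ((e , s , joins) ◅ walk) =
    trans (step joins) (Conn-preserves-Closed C closed walk)
    where
    step : ∀ {u w} → E e ≡ (u , w) ⊎ E e ≡ (w , u) → C u ≡ C w
    step (inj₁ refl) = closed e s
    step (inj₂ refl) = sym (closed e s)

  record Arc : Set where
    constructor arc
    field
      edge    : Fin m
      from to : Fin n
      joins   : E edge ≡ (from , to) ⊎ E edge ≡ (to , from)
  open Arc

  arcInto : Fin n → Fin m → Maybe Arc
  arcInto v e with proj₂ (E e) ≟ v | proj₁ (E e) ≟ v
  ... | yes refl | _        = just (arc e (proj₁ (E e)) v (inj₁ refl))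
  ... | no _     | yes refl = just (arc e (proj₂ (E e)) v (inj₂ refl))
  ... | no _     | no _     = nothing

  Arcs : Set
  Arcs = Vec (List Arc) n

  -- The table of arcs into each vertex only saves recomputation: grow re-checks the target of
  -- every arc it uses, so reachability is sound for any table.
  arcs : Arcs
  arcs = tabulate λ v → mapMaybe (arcInto v) (allFin m)

  grow : Arcs → ESet m → Vec Bool n → Vec Bool n
  grow N S C = tabulate λ v →
    lookup C v ∨ any (λ a → S (edge a) ∧ lookup C (from a) ∧ ⌊ to a ≟ v ⌋) (lookup N v)

  reach : Arcs → ESet m → ℕ → Vec Bool n → Vec Bool n
  reach N S zero    C = C
  reach N S (suc k) C = grow N S (reach N S k C)

  grow-sound : ∀ {N S C v} → T (lookup (grow N S C) v) →
               T (lookup C v) ⊎ ∃ λ u → T (lookup C u) × Adj E S u v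
  grow-sound {N} {S} {C} {v} grown with Equivalence.to T-∨ (subst T (lookup∘tabulate _ v) grown)
  ... | inj₁ old = inj₁ old
  ... | inj₂ new with satisfied (any⁻ _ (lookup N v) new)
  ... | a , usable with Equivalence.to T-∧ usable
  ... | s , rest with Equivalence.to T-∧ rest
  ... | c , to≡v =
    inj₂ (from a , c ,
          subst (Adj E S (from a)) (toWitness to≡v) (edge a , Equivalence.to T-≡ s , joins a))

  reach-sound : ∀ {N S C v} k → T (lookup (reach N S k C) v) →
                ∃ λ u → T (lookup C u) × Conn E S u v
  reach-sound zero c = _ , c , ε
  reach-sound {N} {S} {C} (suc k) r with grow-sound {N} {S} {reach N S k C} r
  ... | inj₁ old = reach-sound k old
  ... | inj₂ (u , r′ , adj) with reach-sound {N} {S} {C} k r′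
  ... | w , c , walk = w , c , walk ◅◅ (adj ◅ ε)

  component : Arcs → ESet m → VSet n → Vec Bool n
  component N S X = reach N S n (tabulate X)

  component-sound : ∀ {N S X v} → T (lookup (component N S X) v) → ∃ λ u → T (X u) × Conn E S u v
  component-sound {N} {S} {X} r with reach-sound {N} {S} {tabulate X} n r
  ... | u , c , walk = u , subst T (lookup∘tabulate X u) c , walk

  reached-from : ∀ {N S ρ v} → T (lookup (component N S ⁅ ρ ⁆) v) → Conn E S ρ v
  reached-from {N} {S} {ρ} r with component-sound {N} {S} {⁅ ρ ⁆} r
  ... | u , u∈ , walk = subst (λ u → Conn E S u _) (toWitness u∈) walk

  Ranked : (Fin n → Fin n) → (Fin n → ℕ) → ESet m → Set
  Ranked p r S = ∀ e → S e ≡ true → ParentWalks._—_ p r (proj₁ (E e)) (proj₂ (E e))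

  ranked? : ∀ p r S → Dec (Ranked p r S)
  ranked? p r S = all? λ e → S e ≟ᵇ true →-dec step? (proj₁ (E e)) (proj₂ (E e))
    where
    step? : ∀ a b → Dec (ParentWalks._—_ p r a b)
    step? a b = (p a ≟ b ×-dec r b <? r a) ⊎-dec (p b ≟ a ×-dec r a <? r b)

  Ranked⇒acyclic : ∀ p r {S} → Ranked p r S → ¬ HasCycle E S
  Ranked⇒acyclic p r {S} ranked (v , ws , long , unique , walk) =
    no-closed-walk long unique (Linked.map Adj⇒— walk)
    where
    open ParentWalks p r
    Adj⇒— : ∀ {a b} → Adj E S a b → a — b
    Adj⇒— (e , s , inj₁ refl) = ranked e s
    Adj⇒— (e , s , inj₂ refl) = —-sym (ranked e s)

  -- Depths and parents are computed by a breadth-first search from X without proof; Layered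
  -- checks all that is used of them.
  depths : ESet m → VSet n → Vec ℕ n
  depths S X = unreached-in (iterate (grow arcs S) (tabulate X) n)
    where
    unreached-in : List (Vec Bool n) → Vec ℕ n
    unreached-in layers = tabulate λ v → length (filterᵇ (λ R → not (lookup R v)) layers)

  parents : ESet m → Vec ℕ n → Vec (Fin n) n
  parents S D = tabulate λ v →
    maybe′ from v (findᵇ (λ a → S (edge a) ∧ (lookup D (from a) <ᵇ lookup D v)) (lookup arcs v))

  Layered : ESet m → Vec ℕ n → Set
  Layered S D = Ranked (lookup (parents S D)) (lookup D) S

  layered? : ∀ S D → Dec (Layered S D)
  layered? S D = ranked? (lookup (parents S D)) (lookup D) S

  Layered⇒acyclic : ∀ {S} D → Layered S D → ¬ HasCycle E S
  Layered⇒acyclic {S} D = Ranked⇒acyclic (lookup (parents S D)) (lookup D)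

  Covers : VSet n → Vec Bool n → Set
  Covers K C = ∀ v → K v ≡ true → T (lookup C v)

  covers? : ∀ K C → Dec (Covers K C)
  covers? K C = all? λ v → K v ≟ᵇ true →-dec T? (lookup C v)

  edgesIn? : ∀ K S → Dec (EdgesIn E K S)
  edgesIn? K S = all? λ e →
    S e ≟ᵇ true →-dec (K (proj₁ (E e)) ≟ᵇ true ×-dec K (proj₂ (E e)) ≟ᵇ true)

  excluded? : ∀ K x y S → Dec (Excluded E K x y S)
  excluded? K x y S = all? λ v →
    K v ≟ᵇ true →-dec ¬? (v ≟ x) →-dec ¬? (v ≟ y) →-dec ¬? (deg E S v ℕ.≟ 2)

  HISTCertificate : VSet n → Fin n → Fin n → ESet m → Fin n → Set
  HISTCertificate K x y S ρ = EdgesIn E K S × Layered S (depths S ⁅ ρ ⁆)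
                            × Covers K (component arcs S ⁅ ρ ⁆) × Excluded E K x y S

  histCertificate? : ∀ K x y S ρ → Dec (HISTCertificate K x y S ρ)
  histCertificate? K x y S ρ = edgesIn? K S ×-dec layered? S (depths S ⁅ ρ ⁆)
                             ×-dec covers? K (component arcs S ⁅ ρ ⁆) ×-dec excluded? K x y S

  HISTCertificate⇒HIST : ∀ {K x y S ρ} → HISTCertificate K x y S ρ → HIST E K x y S
  HISTCertificate⇒HIST {K} {S = S} {ρ} (edgesIn , layered , covers , excluded) =
    ((edgesIn , Layered⇒acyclic (depths S ⁅ ρ ⁆) layered) , connected) , excluded
    where
    connected : ∀ u v → K u ≡ true → K v ≡ true → Conn E S u v
    connected u v Ku Kv = Conn-sym (reached-from (covers u Ku)) ◅◅ reached-from (covers v Kv)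

  Splits : VSet n → Fin n → Fin n → ESet m → Vec Bool n → Vec Bool n → Set
  Splits K x y S Cx Cy = Closed S (lookup Cx) × T (lookup Cx x) × ¬ T (lookup Cx y)
                       × (∀ v → K v ≡ true → T (lookup Cx v) ⊎ T (lookup Cy v))
                       × (∃ λ u → u ≢ x × T (lookup Cx u))
                       × (∃ λ u → u ≢ y × T (lookup Cy u))

  splits? : ∀ K x y S Cx Cy → Dec (Splits K x y S Cx Cy)
  splits? K x y S Cx Cy =
    closed? S (lookup Cx) ×-dec T? (lookup Cx x) ×-dec ¬? (T? (lookup Cx y))
    ×-dec all? (λ v → K v ≟ᵇ true →-dec (T? (lookup Cx v) ⊎-dec T? (lookup Cy v)))
    ×-dec any? (λ u → ¬? (u ≟ x) ×-dec T? (lookup Cx u))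
    ×-dec any? (λ u → ¬? (u ≟ y) ×-dec T? (lookup Cy u))

  TwoTreesCertificate : VSet n → Fin n → Fin n → ESet m → Set
  TwoTreesCertificate K x y S = EdgesIn E K S × Layered S (depths S (⁅ x ⁆ ∪ ⁅ y ⁆))
    × Excluded E K x y S × Splits K x y S (component arcs S ⁅ x ⁆) (component arcs S ⁅ y ⁆)

  twoTreesCertificate? : ∀ K x y S → Dec (TwoTreesCertificate K x y S)
  twoTreesCertificate? K x y S = edgesIn? K S ×-dec layered? S (depths S (⁅ x ⁆ ∪ ⁅ y ⁆))
    ×-dec excluded? K x y S ×-dec splits? K x y S (component arcs S ⁅ x ⁆) (component arcs S ⁅ y ⁆)

  TwoTreesCertificate⇒TwoCompHISF : ∀ {K x y S} → TwoTreesCertificate K x y S → TwoCompHISF E K x y S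
  TwoTreesCertificate⇒TwoCompHISF {K} {x} {y} {S}
    (edgesIn , layered , excluded , closed , x∈ , y∉ , covers , (u , u≢x , u∈) , (w , w≢y , w∈)) =
    ((edgesIn , Layered⇒acyclic (depths S (⁅ x ⁆ ∪ ⁅ y ⁆)) layered) , excluded) ,
    (λ walk → y∉ (subst T (Conn-preserves-Closed (lookup Cx) closed walk) x∈)) ,
    (λ v Kv → Sum.map reached-from reached-from (covers v Kv)) ,
    (u , u≢x , reached-from u∈) , (w , w≢y , reached-from w∈)
    where
    Cx : Vec Bool n
    Cx = component arcs S ⁅ x ⁆

-- Branch and bound over edge sets

module IntervalSearch {m : ℕ} {P : ESet m → Set}
  {Settled : Fin m → ESet m → ESet m → Set}
  (settled? : ∀ e L U → Dec (Settled e L U))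
  (Settled⇒P : ∀ {e L U} → Settled e L U → ∀ {S} → L ⊆ S → S ⊆ U → P S) where

  undecided : Vec Bool m → Vec Bool m → Maybe (Fin m)
  undecided L U = findᵇ (λ e → not (lookup L e) ∧ lookup U e) (allFin m)

  mutual
    search : ℕ → Vec Bool m → Vec Bool m → Bool
    search zero    L U = false
    search (suc k) L U = maybe′ branch false (undecided L U)
      where
      branch : Fin m → Bool
      branch e = search-after k e L (U [ e ]≔ false) ∧ search-after k e (L [ e ]≔ true) U

    search-after : ℕ → Fin m → Vec Bool m → Vec Bool m → Bool
    search-after k e L U = ⌊ settled? e (lookup L) (lookup U) ⌋ ∨ search k L U

  insert-⊆ : ∀ {S : ESet m} {L e} → S e ≡ true → lookup L ⊆ S → lookup (L [ e ]≔ true) ⊆ S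
  insert-⊆ {S} {L} {e} Se L⊆S i with i ≟ e
  ... | yes refl = λ _ → Se
  ... | no i≢e   = λ Li → L⊆S i (trans (sym (lookup∘update′ i≢e L true)) Li)

  remove-⊆ : ∀ {S : ESet m} {U e} → S e ≡ false → S ⊆ lookup U → S ⊆ lookup (U [ e ]≔ false)
  remove-⊆ {S} {U} {e} Se S⊆U i Si with i ≟ e
  ... | yes refl with trans (sym Si) Se
  ...   | ()
  remove-⊆ {S} {U} {e} Se S⊆U i Si | no i≢e = trans (lookup∘update′ i≢e U false) (S⊆U i Si)

  mutual
    search-sound : ∀ k L U → T (search k L U) → ∀ {S} → lookup L ⊆ S → S ⊆ lookup U → P S
    search-sound (suc k) L U ok {S} L⊆S S⊆U with undecided L U
    ... | just e with Equivalence.to (T-∧ {search-after k e L (U [ e ]≔ false)}) ok | S e in Se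
    ...   | without-e , _ | false =
      search-after-sound k e L (U [ e ]≔ false) without-e L⊆S (remove-⊆ {U = U} Se S⊆U)
    ...   | _ , with-e    | true  =
      search-after-sound k e (L [ e ]≔ true) U with-e (insert-⊆ {L = L} Se L⊆S) S⊆U

    search-after-sound : ∀ k e L U → T (search-after k e L U) →
                         ∀ {S} → lookup L ⊆ S → S ⊆ lookup U → P S
    search-after-sound k e L U ok with Equivalence.to T-∨ ok
    ... | inj₁ settled  = Settled⇒P (toWitness settled)
    ... | inj₂ searched = search-sound k L U searched

  search-all : Bool
  search-all = search m (replicate m false) (replicate m true)

  search-all-sound : T search-all → ∀ S → P S
  search-all-sound ok S = search-sound m _ _ ok nothing-in-∅ (λ i _ → lookup-replicate i true)
    where
    nothing-in-∅ : lookup (replicate m false) ⊆ S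
    nothing-in-∅ i ∅i with trans (sym (lookup-replicate i false)) ∅i
    ... | ()

-- HIST-critical fragments

module Fragment {n m : ℕ} (E : Graph n m) (x y : Fin n) where
  open Graphs E

  DegreeTwoForced : ESet m → ESet m → Fin n → Set
  DegreeTwoForced L U v = v ≢ x × v ≢ y × deg E L v ≡ 2 × deg E U v ≡ 2

  degreeTwoForced? : ∀ L U v → Dec (DegreeTwoForced L U v)
  degreeTwoForced? L U v =
    ¬? (v ≟ x) ×-dec ¬? (v ≟ y) ×-dec deg E L v ℕ.≟ 2 ×-dec deg E U v ℕ.≟ 2

  DegreeTwoForced⇒¬Excluded : ∀ {L U S v} → DegreeTwoForced L U v → L ⊆ S → S ⊆ U →
                              ¬ Excluded E allV x y S
  DegreeTwoForced⇒¬Excluded {v = v} (v≢x , v≢y , degL , degU) L⊆S S⊆U excluded =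
    excluded v refl v≢x v≢y (deg-squeeze L⊆S S⊆U v degL degU)

  Separated : ESet m → VSet n → Vec Bool n → Set
  Separated U X C =
    Closed U (lookup C) × (∀ v → T (X v) → T (lookup C v)) × ∃ λ w → ¬ T (lookup C w)

  separated? : ∀ U X C → Dec (Separated U X C)
  separated? U X C = closed? U (lookup C) ×-dec all? (λ v → T? (X v) →-dec T? (lookup C v))
                                          ×-dec any? (λ w → ¬? (T? (lookup C w)))

  Separated⇒disconnected : ∀ {U X C S} → Separated U X C → S ⊆ U →
                           ∃ λ w → ∀ {s} → T (X s) → ¬ Conn E S s w
  Separated⇒disconnected {C = C} (closed , X⊆C , w , w∉C) S⊆U = w , λ Xs walk →
    w∉C (subst T (Conn-preserves-Closed (lookup C) (Closed-anti (lookup C) S⊆U closed) walk) (X⊆C _ Xs))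

  Isolated⇒unreachable : ∀ {U S v u} → Closed U ⁅ v ⁆ → S ⊆ U → Conn E S v u → u ≡ v
  Isolated⇒unreachable {v = v} closed S⊆U walk =
    toWitness (subst T (Conn-preserves-Closed ⁅ v ⁆ (Closed-anti ⁅ v ⁆ S⊆U closed) walk)
                       (x∈⁅x⁆ v))

  DegreeTwoAtTerminals : ESet m → Set
  DegreeTwoAtTerminals S = HIST E allV x y S → deg E S x ≡ 2 × deg E S y ≡ 2

  -- e is the edge decided last, so only its endpoints can have acquired a forced degree 2.  The
  -- arc table is a parameter so that a whole search shares a single copy of it.
  module _ (N : Arcs) where
    Settled₁ : Fin m → ESet m → ESet m → Set
    Settled₁ e L U = DegreeTwoForced L U (proj₁ (E e)) ⊎ DegreeTwoForced L U (proj₂ (E e))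
                   ⊎ (deg E L x ≡ 2 × deg E U x ≡ 2 × deg E L y ≡ 2 × deg E U y ≡ 2)
                   ⊎ Separated U ⁅ x ⁆ (component N U ⁅ x ⁆)

    settled₁? : ∀ e L U → Dec (Settled₁ e L U)
    settled₁? e L U = degreeTwoForced? L U (proj₁ (E e)) ⊎-dec degreeTwoForced? L U (proj₂ (E e))
                    ⊎-dec (deg E L x ℕ.≟ 2 ×-dec deg E U x ℕ.≟ 2
                           ×-dec deg E L y ℕ.≟ 2 ×-dec deg E U y ℕ.≟ 2)
                    ⊎-dec separated? U ⁅ x ⁆ (component N U ⁅ x ⁆)

    Settled₁⇒DegreeTwo : ∀ {e L U} → Settled₁ e L U →
                         ∀ {S} → L ⊆ S → S ⊆ U → DegreeTwoAtTerminals S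
    Settled₁⇒DegreeTwo (inj₁ forced) L⊆S S⊆U (_ , excluded) =
      ⊥-elim (DegreeTwoForced⇒¬Excluded forced L⊆S S⊆U excluded)
    Settled₁⇒DegreeTwo (inj₂ (inj₁ forced)) L⊆S S⊆U (_ , excluded) =
      ⊥-elim (DegreeTwoForced⇒¬Excluded forced L⊆S S⊆U excluded)
    Settled₁⇒DegreeTwo (inj₂ (inj₂ (inj₁ (dLx , dUx , dLy , dUy)))) L⊆S S⊆U _ =
      deg-squeeze L⊆S S⊆U x dLx dUx , deg-squeeze L⊆S S⊆U y dLy dUy
    Settled₁⇒DegreeTwo {U = U} (inj₂ (inj₂ (inj₂ separated))) L⊆S S⊆U ((_ , connected) , _) =
      let w , disconnected = Separated⇒disconnected {C = component N U ⁅ x ⁆} separated S⊆U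
      in ⊥-elim (disconnected (x∈⁅x⁆ x) (connected x w refl refl))

    Settled₄ : Fin m → ESet m → ESet m → Set
    Settled₄ e L U = DegreeTwoForced L U (proj₁ (E e)) ⊎ DegreeTwoForced L U (proj₂ (E e))
                   ⊎ Separated U (⁅ x ⁆ ∪ ⁅ y ⁆) (component N U (⁅ x ⁆ ∪ ⁅ y ⁆))
                   ⊎ Closed U ⁅ x ⁆ ⊎ Closed U ⁅ y ⁆ ⊎ T (lookup (component N L ⁅ x ⁆) y)

    settled₄? : ∀ e L U → Dec (Settled₄ e L U)
    settled₄? e L U = degreeTwoForced? L U (proj₁ (E e)) ⊎-dec degreeTwoForced? L U (proj₂ (E e))
                    ⊎-dec separated? U (⁅ x ⁆ ∪ ⁅ y ⁆) (component N U (⁅ x ⁆ ∪ ⁅ y ⁆))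
                    ⊎-dec closed? U ⁅ x ⁆ ⊎-dec closed? U ⁅ y ⁆
                    ⊎-dec T? (lookup (component N L ⁅ x ⁆) y)

    Settled₄⇒¬TwoCompHISF : ∀ {e L U} → Settled₄ e L U →
                            ∀ {S} → L ⊆ S → S ⊆ U → ¬ TwoCompHISF E allV x y S
    Settled₄⇒¬TwoCompHISF (inj₁ forced) L⊆S S⊆U ((_ , excluded) , _) =
      DegreeTwoForced⇒¬Excluded forced L⊆S S⊆U excluded
    Settled₄⇒¬TwoCompHISF (inj₂ (inj₁ forced)) L⊆S S⊆U ((_ , excluded) , _) =
      DegreeTwoForced⇒¬Excluded forced L⊆S S⊆U excluded
    Settled₄⇒¬TwoCompHISF {U = U} (inj₂ (inj₂ (inj₁ separated))) L⊆S S⊆U (_ , _ , covered , _)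
      with Separated⇒disconnected {C = component N U (⁅ x ⁆ ∪ ⁅ y ⁆)} separated S⊆U
    ... | w , disconnected with covered w refl
    ...   | inj₁ x⇝w = disconnected (Equivalence.from T-∨ (inj₁ (x∈⁅x⁆ x))) x⇝w
    ...   | inj₂ y⇝w = disconnected (Equivalence.from T-∨ (inj₂ (x∈⁅x⁆ y))) y⇝w
    Settled₄⇒¬TwoCompHISF (inj₂ (inj₂ (inj₂ (inj₁ isolated)))) L⊆S S⊆U
      (_ , _ , _ , (u , u≢x , x⇝u) , _) =
      u≢x (Isolated⇒unreachable isolated S⊆U x⇝u)
    Settled₄⇒¬TwoCompHISF (inj₂ (inj₂ (inj₂ (inj₂ (inj₁ isolated))))) L⊆S S⊆U
      (_ , _ , _ , _ , (u , u≢y , y⇝u)) =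
      u≢y (Isolated⇒unreachable isolated S⊆U y⇝u)
    Settled₄⇒¬TwoCompHISF (inj₂ (inj₂ (inj₂ (inj₂ (inj₂ joined))))) L⊆S S⊆U (_ , x≁y , _)
      with component-sound joined
    ... | u , u∈ , u⇝y = x≁y (Conn-mono L⊆S (subst (λ u → Conn E _ u y) (toWitness u∈) u⇝y))

  record Certificate : Set where
    field
      tree tree-x tree-y : ESet m
      after-deleting     : Fin n → ESet m
  open Certificate

  Valid : Certificate → Set
  Valid c = x ≢ y × 3 ≤ n
    × HISTCertificate allV x y (tree c) x
    × (HISTCertificate (minus x) x y (tree-x c) y × deg E (tree-x c) y ≢ 1)
    × (HISTCertificate (minus y) x y (tree-y c) x × deg E (tree-y c) x ≢ 1)
    × (∀ v → v ≢ x → v ≢ y →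
         (HISTCertificate (minus v) x y (after-deleting c v) x
           × (deg E (after-deleting c v) x ≢ 2 ⊎ deg E (after-deleting c v) y ≢ 2))
         ⊎ TwoTreesCertificate (minus v) x y (after-deleting c v))

  valid? : ∀ c → Dec (Valid c)
  valid? c = ¬? (x ≟ y) ×-dec 3 ≤? n
    ×-dec histCertificate? allV x y (tree c) x
    ×-dec (histCertificate? (minus x) x y (tree-x c) y ×-dec ¬? (deg E (tree-x c) y ℕ.≟ 1))
    ×-dec (histCertificate? (minus y) x y (tree-y c) x ×-dec ¬? (deg E (tree-y c) x ℕ.≟ 1))
    ×-dec all? λ v → ¬? (v ≟ x) →-dec ¬? (v ≟ y) →-dec
            ((histCertificate? (minus v) x y (after-deleting c v) x
               ×-dec (¬? (deg E (after-deleting c v) x ℕ.≟ 2)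
                      ⊎-dec ¬? (deg E (after-deleting c v) y ℕ.≟ 2)))
             ⊎-dec twoTreesCertificate? (minus v) x y (after-deleting c v))

  valid⇒critical : ∀ c → Valid c → (∀ S → DegreeTwoAtTerminals S) →
                   (∀ S → ¬ TwoCompHISF E allV x y S) → HISTCriticalFragment E x y
  valid⇒critical c (x≢y , 3≤n , hist , (hist-x , deg-x) , (hist-y , deg-y) , deletions) degrees no-two =
    record
    { x≢y       = x≢y
    ; ℓ≥1       = 3≤n
    ; c1-exists = tree c , HISTCertificate⇒HIST hist
    ; c1-deg    = degrees
    ; c2-x      = tree-x c , HISTCertificate⇒HIST hist-x , deg-x
    ; c2-y      = tree-y c , HISTCertificate⇒HIST hist-y , deg-y
    ; c3        = λ v v≢x v≢y →
        Sum.map (λ (hist-v , deg-v) → after-deleting c v , HISTCertificate⇒HIST hist-v , deg-v)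
                (λ two → after-deleting c v , TwoTreesCertificate⇒TwoCompHISF two)
                (deletions v v≢x v≢y)
    ; c4        = λ (S , two) → no-two S two
    }

  module Search₁ = IntervalSearch (settled₁? arcs) (Settled₁⇒DegreeTwo arcs)
  module Search₄ = IntervalSearch (settled₄? arcs) (Settled₄⇒¬TwoCompHISF arcs)

  verify : Certificate → Bool
  verify c = ⌊ valid? c ⌋ ∧ Search₁.search-all ∧ Search₄.search-all

  critical : ∀ c → T (verify c) → HISTCriticalFragment E x y
  critical c ok =
    let valid , searched = Equivalence.to (T-∧ {⌊ valid? c ⌋}) ok
        degrees , no-two = Equivalence.to (T-∧ {Search₁.search-all}) searched
    in valid⇒critical c (toWitness valid)
                      (Search₁.search-all-sound degrees) (Search₄.search-all-sound no-two)

open Fragment using (Certificate; critical)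

edges : ∀ {m} → List ℕ → ESet m
edges es e = any (toℕ e ≡ᵇ_) es

-- Edges are numbered from 0 in the order of the edge lists of F₁ and F₂; after-deleting gives, for
-- each vertex v, the witness of condition (3) for F − v (the entries for x and y are never used).

certificate₁ : Certificate F₁ (# 0) (# 1)
certificate₁ = record
  { tree           = edges (0 ∷ 1 ∷ 2 ∷ 3 ∷ 6 ∷ 7 ∷ 8 ∷ [])
  ; tree-x         = edges (2 ∷ 3 ∷ 4 ∷ 5 ∷ 7 ∷ 8 ∷ [])
  ; tree-y         = edges (0 ∷ 1 ∷ 5 ∷ 6 ∷ 7 ∷ 9 ∷ [])
  ; after-deleting = edges ∘ lookup
      ( [] ∷ []
      ∷ (0 ∷ 1 ∷ 3 ∷ 6 ∷ 7 ∷ 8 ∷ [])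
      ∷ (1 ∷ 2 ∷ 3 ∷ 7 ∷ 8 ∷ [])
      ∷ (1 ∷ 2 ∷ 3 ∷ 4 ∷ 5 ∷ 9 ∷ [])
      ∷ (0 ∷ 1 ∷ 2 ∷ 4 ∷ 5 ∷ 9 ∷ [])
      ∷ (0 ∷ 2 ∷ 3 ∷ 4 ∷ 5 ∷ [])
      ∷ (0 ∷ 2 ∷ 3 ∷ 6 ∷ 7 ∷ 8 ∷ [])
      ∷ [])
  }

certificate₂ : Certificate F₂ (# 0) (# 1)
certificate₂ = record
  { tree           = edges (0 ∷ 1 ∷ 2 ∷ 3 ∷ 4 ∷ 5 ∷ 8 ∷ 10 ∷ 11 ∷ 13 ∷ 14 ∷ [])
  ; tree-x         = edges (2 ∷ 3 ∷ 5 ∷ 7 ∷ 8 ∷ 9 ∷ 10 ∷ 11 ∷ 13 ∷ 14 ∷ [])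
  ; tree-y         = edges (0 ∷ 1 ∷ 5 ∷ 6 ∷ 7 ∷ 8 ∷ 9 ∷ 10 ∷ 11 ∷ 15 ∷ [])
  ; after-deleting = edges ∘ lookup
      ( [] ∷ []
      ∷ (1 ∷ 2 ∷ 3 ∷ 7 ∷ 8 ∷ 9 ∷ 10 ∷ 11 ∷ 14 ∷ 15 ∷ [])
      ∷ (1 ∷ 2 ∷ 3 ∷ 5 ∷ 8 ∷ 10 ∷ 11 ∷ 13 ∷ 14 ∷ [])
      ∷ (0 ∷ 1 ∷ 3 ∷ 4 ∷ 5 ∷ 11 ∷ 12 ∷ 13 ∷ 14 ∷ [])
      ∷ (1 ∷ 2 ∷ 3 ∷ 4 ∷ 5 ∷ 6 ∷ 9 ∷ 12 ∷ 15 ∷ [])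
      ∷ (0 ∷ 1 ∷ 3 ∷ 5 ∷ 6 ∷ 7 ∷ 8 ∷ 9 ∷ 15 ∷ [])
      ∷ (0 ∷ 1 ∷ 3 ∷ 7 ∷ 8 ∷ 9 ∷ 10 ∷ 11 ∷ 14 ∷ 15 ∷ [])
      ∷ (0 ∷ 1 ∷ 2 ∷ 7 ∷ 8 ∷ 9 ∷ 10 ∷ 11 ∷ 15 ∷ [])
      ∷ (0 ∷ 2 ∷ 3 ∷ 4 ∷ 5 ∷ 8 ∷ 10 ∷ 11 ∷ 13 ∷ 14 ∷ [])
      ∷ (0 ∷ 1 ∷ 2 ∷ 5 ∷ 6 ∷ 7 ∷ 8 ∷ 9 ∷ 12 ∷ 15 ∷ [])
      ∷ (0 ∷ 1 ∷ 3 ∷ 4 ∷ 5 ∷ 8 ∷ 10 ∷ 11 ∷ 14 ∷ [])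
      ∷ [])
  }

proposition2 : HISTCriticalFragment F₁ (# 0) (# 1) × HISTCriticalFragment F₂ (# 0) (# 1)
proposition2 = critical F₁ (# 0) (# 1) certificate₁ _ , critical F₂ (# 0) (# 1) certificate₂ _
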